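{- Let $G=(V,E)$ be a graph. Then: (a) $r_\Delta(G)\ge\alpha(G)$; (b) if $S\subseteq V$ is Radon independent, then no three vertices of $S$ form a $K_3$ (triangle) in $G$; (c) if every pair of adjacent vertices $u,v$ of $G$ forms a hull set (i.e. $\langle\{u,v\}\rangle=V$), then $r_\Delta(G)=\max\{2,\alpha(G)\}$.
   Context: All graphs are finite, simple, undirected and connected. $\alpha(G)$ is the independence number of $G$. For $S\subseteq V$, the $\Delta$-interval $[S]$ is the set consisting of all vertices of $S$ together with every vertex $v\in V$ adjacent to both $x$ and $y$ for some pair of adjacent vertices $x,y\in S$. A set $S$ is $\Delta$-convex if $[S]=S$, and $\langle S\rangle$ denotes the smallest $\Delta$-convex set containing $S$ ($\langle\emptyset\rangle=\emptyset$). A set $S$ is Radon dependent if there is a partition $\{S_1,S_2\}$ of $S$ with $\langle S_1\rangle\cap\langle S_2\rangle\neq\emptyset$, and Radon independent otherwise. The Radon number $r_\Delta(G)$ is the least integer $n\ge0$ such that every $S\subseteq V$ with $|S|>n$ is Radon dependent (equivalently, the maximum size of a Radon independent set). -}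

module Defs where

open import Data.Nat using (ℕ; _≤_; _<_)
open import Data.Fin using (Fin)
open import Data.Fin.Subset using (Subset; _∈_; _∉_; _⊆_; _─_; ∣_∣)
open import Data.Product using (Σ; _×_; ∃)
open import Relation.Nullary using (¬_)
open import Relation.Binary.PropositionalEquality using (_≡_)
open import Relation.Binary using (Decidable)
open import Relation.Binary.Construct.Closure.ReflexiveTransitive using (Star)

record Graph (n : ℕ) : Set₁ where
  field
    _~_     : Fin n → Fin n → Set
    ~-dec   : Decidable _~_
    ~-sym   : ∀ {x y} → x ~ y → y ~ x
    ~-irrefl : ∀ {x} → ¬ (x ~ x)
    connected : ∀ x y → Star _~_ x y

module _ {n : ℕ} (G : Graph n) where
  open Graph G

  IsΔConvex : Subset n → Set
  IsΔConvex S = ∀ {x y v} → x ∈ S → y ∈ S → x ~ y → v ~ x → v ~ y → v ∈ S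

  -- membership in ⟨S⟩, the smallest Δ-convex set containing S
  -- (inductively generated: S together with closure under the Δ-interval)
  data InHull (S : Subset n) : Fin n → Set where
    base : ∀ {v} → v ∈ S → InHull S v
    step : ∀ {x y v} → InHull S x → InHull S y → x ~ y → v ~ x → v ~ y → InHull S v

  RadonDependent : Subset n → Set
  RadonDependent S = Σ (Subset n) λ S₁ → S₁ ⊆ S × ∃ λ v → InHull S₁ v × InHull (S ─ S₁) v

  RadonIndependent : Subset n → Set
  RadonIndependent S = ¬ RadonDependent S

  IsRadonNumber : ℕ → Set
  IsRadonNumber r =
    (∀ S → r < ∣ S ∣ → RadonDependent S) ×
    (∀ m → (∀ S → m < ∣ S ∣ → RadonDependent S) → r ≤ m)

  IsIndependent : Subset n → Set
  IsIndependent S = ∀ {x y} → x ∈ S → y ∈ S → ¬ (x ~ y)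

  IsIndependenceNumber : ℕ → Set
  IsIndependenceNumber a =
    (Σ (Subset n) λ S → IsIndependent S × ∣ S ∣ ≡ a) ×
    (∀ S → IsIndependent S → ∣ S ∣ ≤ a)

-- The Δ-hull of a set without an edge is the set itself, since the Δ-interval
-- only adds common neighbours of adjacent vertices. Hence if S is Radon dependent, one part
-- of the partition contains an edge and the other part is nonempty: S has an edge and a
-- third vertex. So independent sets and sets of at most two vertices are Radon independent,
-- giving r ≥ α and (with two vertices) r ≥ 2. A triangle xyz splits as {x, y} | {z} with z
-- in the hull of the edge xy. Conversely, when every edge is a hull set, a set S with more
-- than max 2 α vertices contains an edge uv and a vertex w outside it, and {u, v} | S − {u, v}
-- meet in w.
module Submission where

open import Defs
open import Data.Nat using (ℕ; _≤_; _<_; _+_; _⊔_; z≤n; s≤s)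
open import Data.Nat.Properties
  using (≤-trans; ≤-reflexive; ≤-antisym; ≤-<-trans; +-suc; +-monoʳ-≤;
         n≤1+n; ≮⇒≥; <⇒≱; ⊔-lub; m≤m⊔n; m≤n⊔m)
open import Data.Fin using (Fin; zero; suc)
open import Data.Fin.Properties using (any?)
open import Data.Fin.Subset using (Subset; _∈_; _∉_; _⊆_; _─_; _-_; _∪_; ⁅_⁆; ∣_∣; Nonempty; Empty;
                                    inside; outside)
open import Data.Fin.Subset.Properties
  using (_∈?_; nonempty?; x∈⁅x⁆; x∈⁅y⁆⇒x≡y; x≢y⇒x∉⁅y⁆; ∣⁅x⁆∣≡1; x∈p∪q⁺; x∈p∪q⁻;
         x∈p∧x∉q⇒x∈p─q; p─q⊆p; p⊆q⇒∣p∣≤∣q∣; x∈p⇒∣p-x∣<∣p∣)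
open import Data.Vec using (_∷_; []; here; there)
open import Data.Product using (_×_; ∃; ∃₂; _,_)
open import Data.Sum using (_⊎_; inj₁; inj₂)
open import Data.Empty using (⊥-elim)
open import Function using (_∘_)
open import Relation.Nullary using (¬_; yes; no)
open import Relation.Nullary.Decidable using (_×-dec_)
open import Relation.Binary.PropositionalEquality using (_≡_; _≢_; refl; sym; subst; ≢-sym)

∣p∪q∣≤∣p∣+∣q∣ : ∀ {n} (p q : Subset n) → ∣ p ∪ q ∣ ≤ ∣ p ∣ + ∣ q ∣
∣p∪q∣≤∣p∣+∣q∣ []            []            = z≤n
∣p∪q∣≤∣p∣+∣q∣ (inside ∷ p)  (inside ∷ q)  = s≤s (≤-trans (∣p∪q∣≤∣p∣+∣q∣ p q) (+-monoʳ-≤ ∣ p ∣ (n≤1+n _)))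
∣p∪q∣≤∣p∣+∣q∣ (inside ∷ p)  (outside ∷ q) = s≤s (∣p∪q∣≤∣p∣+∣q∣ p q)
∣p∪q∣≤∣p∣+∣q∣ (outside ∷ p) (inside ∷ q)  = ≤-trans (s≤s (∣p∪q∣≤∣p∣+∣q∣ p q)) (≤-reflexive (sym (+-suc ∣ p ∣ ∣ q ∣)))
∣p∪q∣≤∣p∣+∣q∣ (outside ∷ p) (outside ∷ q) = ∣p∪q∣≤∣p∣+∣q∣ p q

x∈p─q⇒x∉q : ∀ {n} (p q : Subset n) {x} → x ∈ p ─ q → x ∉ q
x∈p─q⇒x∉q (_ ∷ p) (outside ∷ q) here       ()
x∈p─q⇒x∉q (_ ∷ p) (_ ∷ q)       (there x∈) (there x∈q) = x∈p─q⇒x∉q p q x∈ x∈q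

x∈p∧y∉p⇒x≢y : ∀ {n} {p : Subset n} {x y} → x ∈ p → y ∉ p → x ≢ y
x∈p∧y∉p⇒x≢y x∈p y∉p refl = y∉p x∈p

Empty[p─q]⇒p⊆q : ∀ {n} {p q : Subset n} → Empty (p ─ q) → p ⊆ q
Empty[p─q]⇒p⊆q {q = q} empty {x} x∈p with x ∈? q
... | yes x∈q = x∈q
... | no  x∉q = ⊥-elim (empty (x , x∈p∧x∉q⇒x∈p─q x∈p x∉q))

x∈⁅y⁆∪⁅z⁆⇒x≡y⊎x≡z : ∀ {n} {x : Fin n} y z → x ∈ ⁅ y ⁆ ∪ ⁅ z ⁆ → x ≡ y ⊎ x ≡ z
x∈⁅y⁆∪⁅z⁆⇒x≡y⊎x≡z y z x∈ with x∈p∪q⁻ ⁅ y ⁆ ⁅ z ⁆ x∈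
... | inj₁ x∈⁅y⁆ = inj₁ (x∈⁅y⁆⇒x≡y y x∈⁅y⁆)
... | inj₂ x∈⁅z⁆ = inj₂ (x∈⁅y⁆⇒x≡y z x∈⁅z⁆)

∣⁅x⁆∪⁅y⁆∣≤2 : ∀ {n} (x y : Fin n) → ∣ ⁅ x ⁆ ∪ ⁅ y ⁆ ∣ ≤ 2
∣⁅x⁆∪⁅y⁆∣≤2 x y with ∣p∪q∣≤∣p∣+∣q∣ ⁅ x ⁆ ⁅ y ⁆
... | bound rewrite ∣⁅x⁆∣≡1 x | ∣⁅x⁆∣≡1 y = bound

∣⁅x⁆∪⁅y⁆∣≥2 : ∀ {n} {x y : Fin n} → x ≢ y → 2 ≤ ∣ ⁅ x ⁆ ∪ ⁅ y ⁆ ∣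
∣⁅x⁆∪⁅y⁆∣≥2 {x = x} {y} x≢y = begin
  2                          ≤⟨ s≤s (≤-reflexive (sym (∣⁅x⁆∣≡1 y))) ⟩
  1 + ∣ ⁅ y ⁆ ∣              ≤⟨ s≤s (p⊆q⇒∣p∣≤∣q∣ ⁅y⁆⊆pair-x) ⟩
  1 + ∣ ⁅ x ⁆ ∪ ⁅ y ⁆ - x ∣  ≤⟨ x∈p⇒∣p-x∣<∣p∣ (x∈p∪q⁺ (inj₁ (x∈⁅x⁆ x))) ⟩
  ∣ ⁅ x ⁆ ∪ ⁅ y ⁆ ∣          ∎
  where
  open Data.Nat.Properties.≤-Reasoning
  ⁅y⁆⊆pair-x : ⁅ y ⁆ ⊆ ⁅ x ⁆ ∪ ⁅ y ⁆ - x
  ⁅y⁆⊆pair-x z∈⁅y⁆ with x∈⁅y⁆⇒x≡y y z∈⁅y⁆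
  ... | refl = x∈p∧x∉q⇒x∈p─q (x∈p∪q⁺ (inj₂ z∈⁅y⁆)) (x≢y⇒x∉⁅y⁆ (≢-sym x≢y))

twoDistinct : ∀ {n} → 2 ≤ n → ∃₂ λ (x y : Fin n) → x ≢ y
twoDistinct (s≤s (s≤s _)) = zero , suc zero , λ ()

module _ {n : ℕ} (G : Graph n) where
  open Graph G

  HasEdge : Subset n → Set
  HasEdge T = ∃₂ λ x y → x ∈ T × y ∈ T × x ~ y

  independent⊎hasEdge : ∀ S → IsIndependent G S ⊎ HasEdge S
  independent⊎hasEdge S with any? (λ x → any? (λ y → (x ∈? S) ×-dec ((y ∈? S) ×-dec ~-dec x y)))
  ... | yes edge   = inj₂ edge
  ... | no  ¬edge  = inj₁ λ {x} {y} x∈S y∈S x~y → ¬edge (x , y , x∈S , y∈S , x~y)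

  InHull⇒∈⊎hasEdge : ∀ {T w} → InHull G T w → w ∈ T ⊎ HasEdge T
  InHull⇒∈⊎hasEdge (base w∈T) = inj₁ w∈T
  InHull⇒∈⊎hasEdge (step x∈⟨T⟩ y∈⟨T⟩ x~y _ _)
    with InHull⇒∈⊎hasEdge x∈⟨T⟩ | InHull⇒∈⊎hasEdge y∈⟨T⟩
  ... | inj₁ x∈T | inj₁ y∈T = inj₂ (_ , _ , x∈T , y∈T , x~y)
  ... | inj₂ edge | _        = inj₂ edge
  ... | inj₁ _    | inj₂ edge = inj₂ edge

  InHull⇒nonempty : ∀ {T w} → InHull G T w → Nonempty T
  InHull⇒nonempty (base w∈T)          = _ , w∈T
  InHull⇒nonempty (step x∈⟨T⟩ _ _ _ _) = InHull⇒nonempty x∈⟨T⟩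

  radonDependent⇒edgeAndThirdVertex : ∀ {S} → RadonDependent G S →
    ∃₂ λ x y → x ∈ S × y ∈ S × x ~ y × ∃ λ z → z ∈ S × z ≢ x × z ≢ y
  radonDependent⇒edgeAndThirdVertex {S} (S₁ , S₁⊆S , w , w∈⟨S₁⟩ , w∈⟨S₂⟩)
    with InHull⇒∈⊎hasEdge w∈⟨S₁⟩ | InHull⇒∈⊎hasEdge w∈⟨S₂⟩
  ... | inj₁ w∈S₁ | inj₁ w∈S₂ = ⊥-elim (x∈p─q⇒x∉q S S₁ w∈S₂ w∈S₁)
  ... | inj₂ (x , y , x∈S₁ , y∈S₁ , x~y) | _ =
    let z , z∈S₂ = InHull⇒nonempty w∈⟨S₂⟩
        z∉S₁     = x∈p─q⇒x∉q S S₁ z∈S₂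
    in x , y , S₁⊆S x∈S₁ , S₁⊆S y∈S₁ , x~y ,
       z , p─q⊆p S S₁ z∈S₂ , ≢-sym (x∈p∧y∉p⇒x≢y x∈S₁ z∉S₁) , ≢-sym (x∈p∧y∉p⇒x≢y y∈S₁ z∉S₁)
  ... | inj₁ w∈S₁ | inj₂ (x , y , x∈S₂ , y∈S₂ , x~y) =
    x , y , p─q⊆p S S₁ x∈S₂ , p─q⊆p S S₁ y∈S₂ , x~y ,
    w , S₁⊆S w∈S₁ , x∈p∧y∉p⇒x≢y w∈S₁ (x∈p─q⇒x∉q S S₁ x∈S₂) , x∈p∧y∉p⇒x≢y w∈S₁ (x∈p─q⇒x∉q S S₁ y∈S₂)

  independent⇒radonIndependent : ∀ {S} → IsIndependent G S → RadonIndependent G S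
  independent⇒radonIndependent indep dep
    with radonDependent⇒edgeAndThirdVertex dep
  ... | _ , _ , x∈S , y∈S , x~y , _ = indep x∈S y∈S x~y

  pair-radonIndependent : ∀ u v → RadonIndependent G (⁅ u ⁆ ∪ ⁅ v ⁆)
  pair-radonIndependent u v dep
    with radonDependent⇒edgeAndThirdVertex dep
  ... | x , y , x∈ , y∈ , x~y , z , z∈ , z≢x , z≢y
    with x∈⁅y⁆∪⁅z⁆⇒x≡y⊎x≡z u v x∈ | x∈⁅y⁆∪⁅z⁆⇒x≡y⊎x≡z u v y∈ | x∈⁅y⁆∪⁅z⁆⇒x≡y⊎x≡z u v z∈
  ... | inj₁ refl | inj₁ refl | _         = ~-irrefl x~y
  ... | inj₂ refl | inj₂ refl | _         = ~-irrefl x~y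
  ... | inj₁ refl | _         | inj₁ refl = z≢x refl
  ... | inj₂ refl | _         | inj₂ refl = z≢x refl
  ... | _         | inj₁ refl | inj₁ refl = z≢y refl
  ... | _         | inj₂ refl | inj₂ refl = z≢y refl

  triangle⇒radonDependent : ∀ {S x y z} → x ∈ S → y ∈ S → z ∈ S →
    x ~ y → y ~ z → x ~ z → RadonDependent G S
  triangle⇒radonDependent {S} {x} {y} {z} x∈S y∈S z∈S x~y y~z x~z =
    S ─ ⁅ z ⁆ , p─q⊆p S ⁅ z ⁆ , z ,
    step (base (off-z x∈S x~z)) (base (off-z y∈S y~z)) x~y (~-sym x~z) (~-sym y~z) ,
    base (x∈p∧x∉q⇒x∈p─q z∈S (λ z∈S─z → x∈p─q⇒x∉q S ⁅ z ⁆ z∈S─z (x∈⁅x⁆ z)))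
    where
    off-z : ∀ {t} → t ∈ S → t ~ z → t ∈ S ─ ⁅ z ⁆
    off-z t∈S t~z = x∈p∧x∉q⇒x∈p─q t∈S (x≢y⇒x∉⁅y⁆ λ { refl → ~-irrefl t~z })

  radonIndependent⇒∣∣≤radonNumber : ∀ {S r} → IsRadonNumber G r → RadonIndependent G S → ∣ S ∣ ≤ r
  radonIndependent⇒∣∣≤radonNumber (dependent , _) indep = ≮⇒≥ (indep ∘ dependent _)

  large⇒radonDependent : (∀ u v → u ~ v → ∀ w → InHull G (⁅ u ⁆ ∪ ⁅ v ⁆) w) →
    ∀ {a} → IsIndependenceNumber G a → ∀ S → 2 ⊔ a < ∣ S ∣ → RadonDependent G S
  large⇒radonDependent edgeHull {a} (_ , ≤a) S large with independent⊎hasEdge S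
  ... | inj₁ indep = ⊥-elim (<⇒≱ (≤-<-trans (m≤n⊔m 2 a) large) (≤a S indep))
  ... | inj₂ (u , v , u∈S , v∈S , u~v) with nonempty? (S ─ (⁅ u ⁆ ∪ ⁅ v ⁆))
  ... | yes (w , w∈S─uv) = ⁅ u ⁆ ∪ ⁅ v ⁆ , uv⊆S , w , edgeHull u v u~v w , base w∈S─uv
    where
    uv⊆S : ⁅ u ⁆ ∪ ⁅ v ⁆ ⊆ S
    uv⊆S x∈ with x∈⁅y⁆∪⁅z⁆⇒x≡y⊎x≡z u v x∈
    ... | inj₁ refl = u∈S
    ... | inj₂ refl = v∈S
  ... | no S⊆uv = ⊥-elim (<⇒≱ (≤-<-trans (m≤m⊔n 2 a) large)
                    (≤-trans (p⊆q⇒∣p∣≤∣q∣ (Empty[p─q]⇒p⊆q S⊆uv)) (∣⁅x⁆∪⁅y⁆∣≤2 u v)))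

lemma3 : ∀ {n} (G : Graph n) →
    ((a r : ℕ) → IsIndependenceNumber G a → IsRadonNumber G r → a ≤ r) ×
    ((S : Subset n) → RadonIndependent G S →
      ∀ {x y z} → x ∈ S → y ∈ S → z ∈ S →
      ¬ (Graph._~_ G x y × Graph._~_ G y z × Graph._~_ G x z)) ×
    (2 ≤ n → (∀ u v → Graph._~_ G u v → ∀ w → InHull G (⁅ u ⁆ ∪ ⁅ v ⁆) w) →
      (a r : ℕ) → IsIndependenceNumber G a → IsRadonNumber G r → r ≡ 2 ⊔ a)
lemma3 G = α≤r , triangle-free , r≡2⊔α
  where
  α≤r : ∀ a r → IsIndependenceNumber G a → IsRadonNumber G r → a ≤ r
  α≤r a r ((I , indep , ∣I∣≡a) , _) isR =
    subst (_≤ r) ∣I∣≡a (radonIndependent⇒∣∣≤radonNumber G isR (independent⇒radonIndependent G indep))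

  triangle-free : ∀ S → RadonIndependent G S → ∀ {x y z} → x ∈ S → y ∈ S → z ∈ S →
    ¬ (Graph._~_ G x y × Graph._~_ G y z × Graph._~_ G x z)
  triangle-free S indep x∈S y∈S z∈S (x~y , y~z , x~z) =
    indep (triangle⇒radonDependent G x∈S y∈S z∈S x~y y~z x~z)

  r≡2⊔α : 2 ≤ _ → (∀ u v → Graph._~_ G u v → ∀ w → InHull G (⁅ u ⁆ ∪ ⁅ v ⁆) w) →
    ∀ a r → IsIndependenceNumber G a → IsRadonNumber G r → r ≡ 2 ⊔ a
  r≡2⊔α 2≤n edgeHull a r isα isR@(_ , least) with twoDistinct 2≤n
  ... | u , v , u≢v = ≤-antisym (least (2 ⊔ a) (large⇒radonDependent G edgeHull isα))
    (⊔-lub (≤-trans (∣⁅x⁆∪⁅y⁆∣≥2 u≢v) (radonIndependent⇒∣∣≤radonNumber G isR (pair-radonIndependent G u v)))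
           (α≤r a r isα isR))
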